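{- Let $\Lambda\in\{\mathsf{ALR},\mathsf{PLR}\}$ and let $\Sigma$ be an adequate set. If $\gamma(\varphi,\psi)\in\Sigma$, $T,S\in W_c$ with $T_\Sigma\mathrel{R^\varphi_\Sigma}S_\Sigma$, and either $\psi\in S$ or $\varphi\wedge\gamma(\varphi,\psi)\in S$, then $\gamma(\varphi,\psi)\in T$.
   Context: Formulas: $\varphi ::= p \mid \neg\varphi \mid \varphi\wedge\varphi \mid \Box\varphi \mid \gamma(\varphi,\varphi)$, with $\Diamond\varphi:=\neg\Box\neg\varphi$. $\mathsf{ALR}$: propositional tautologies, Modus Ponens, $\mathsf{S4}$ axioms and rules for $\Box$, plus Axiom 1: $\psi\vee(\varphi\wedge\gamma(\varphi,\psi))\to\Box(\varphi\to\gamma(\varphi,\psi))$; Axiom 2: $\Diamond(\varphi\wedge\gamma(\varphi,\psi))\to\gamma(\varphi,\psi)$; Rule 1: from $\varphi\to\varphi'$, $\psi\to\psi'$ infer $\gamma(\varphi,\psi)\to\gamma(\varphi',\psi')$; Rule 2: from $\psi\to\Box(\varphi\to\psi)$ and $\varphi\wedge\Diamond(\varphi\wedge\psi)\to\psi$ infer $\gamma(\varphi,\psi)\to\Diamond(\varphi\wedge\psi)$. $\mathsf{PLR}$ = $\mathsf{ALR}$ + $\Box(\Box(p\to\Box p)\to p)\to\Box p$. $W_c$ is the set of maximal $\Lambda$-consistent sets of formulas. A set $\Sigma$ is adequate if closed under subformulas and single negations (if $\varphi\in\Sigma$ is not a negation then $\neg\varphi\in\Sigma$), and $\gamma(\varphi,\psi)\in\Sigma$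 implies $\Box(\varphi\to\gamma(\varphi,\psi)),\Diamond(\varphi\wedge\gamma(\varphi,\psi))\in\Sigma$. For $T,S\in W_c$ put $T\sim_\Sigma S$ iff $T\cap\Sigma=S\cap\Sigma$; $T_\Sigma$ is the class of $T$, $W_\Sigma$ the set of classes; $T_\Sigma\preccurlyeq_\Sigma S_\Sigma$ iff $\Box\chi\in T\cap\Sigma$ implies $\Box\chi\in S$. For $\varphi\in\Sigma$, $R^\varphi_\Sigma$ is the least relation on $W_\Sigma$ such that $T_\Sigma\mathrel{R^\varphi_\Sigma}S_\Sigma$ whenever there is $U\in W_c$ with $\varphi\in U$ and either $T_\Sigma\preccurlyeq_\Sigma U_\Sigma\succcurlyeq_\Sigma S_\Sigma$, or $T_\Sigma\mathrel{R^\varphi_\Sigma}U_\Sigma$ and $U_\Sigma\mathrel{R^\varphi_\Sigma}S_\Sigma$. -}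

module Defs where

open import Data.Nat using (ℕ)
open import Data.Bool using (Bool; true; false; not; _∧_)
open import Data.List using (List; []; _∷_)
open import Data.List.Relation.Unary.All using (All)
open import Data.Product using (_×_; Σ; ∃)
open import Data.Sum using (_⊎_)
open import Data.Empty using (⊥)
open import Data.Unit using (⊤)
open import Relation.Nullary using (¬_)
open import Relation.Binary.PropositionalEquality using (_≡_)
open import Level using (Level; suc; zero)

infixr 6 _∧′_
infixr 4 _⇒_

data Formula : Set where
  var  : ℕ → Formula
  ¬′   : Formula → Formula
  _∧′_ : Formula → Formula → Formula
  □    : Formula → Formula
  γ    : Formula → Formula → Formula

_⇒_ : Formula → Formula → Formula
φ ⇒ ψ = ¬′ (φ ∧′ ¬′ ψ)

_∨′_ : Formula → Formula → Formula
φ ∨′ ψ = ¬′ (¬′ φ ∧′ ¬′ ψ)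

◇ : Formula → Formula
◇ φ = ¬′ (□ (¬′ φ))

⊤′ : Formula
⊤′ = var 0 ⇒ var 0

⋀ : List Formula → Formula
⋀ []       = ⊤′
⋀ (φ ∷ φs) = φ ∧′ ⋀ φs

eval : (Formula → Bool) → Formula → Bool
eval v (var p)   = v (var p)
eval v (¬′ φ)    = not (eval v φ)
eval v (φ ∧′ ψ)  = eval v φ ∧ eval v ψ
eval v (□ φ)     = v (□ φ)
eval v (γ φ ψ)   = v (γ φ ψ)

Tautology : Formula → Set
Tautology φ = ∀ (v : Formula → Bool) → eval v φ ≡ true

data Logic : Set where
  ALR PLR : Logic

data ⊢ (Λ : Logic) : Formula → Set where
  taut  : ∀ {φ} → Tautology φ → ⊢ Λ φ
  mp    : ∀ {φ ψ} → ⊢ Λ φ → ⊢ Λ (φ ⇒ ψ) → ⊢ Λ ψ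
  axK   : ∀ {φ ψ} → ⊢ Λ (□ (φ ⇒ ψ) ⇒ (□ φ ⇒ □ ψ))
  axT   : ∀ {φ} → ⊢ Λ (□ φ ⇒ φ)
  ax4   : ∀ {φ} → ⊢ Λ (□ φ ⇒ □ (□ φ))
  nec   : ∀ {φ} → ⊢ Λ φ → ⊢ Λ (□ φ)
  ax1   : ∀ {φ ψ} → ⊢ Λ ((ψ ∨′ (φ ∧′ γ φ ψ)) ⇒ □ (φ ⇒ γ φ ψ))
  ax2   : ∀ {φ ψ} → ⊢ Λ (◇ (φ ∧′ γ φ ψ) ⇒ γ φ ψ)
  rule1 : ∀ {φ φ′ ψ ψ′} → ⊢ Λ (φ ⇒ φ′) → ⊢ Λ (ψ ⇒ ψ′)
        → ⊢ Λ (γ φ ψ ⇒ γ φ′ ψ′)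
  rule2 : ∀ {φ ψ} → ⊢ Λ (ψ ⇒ □ (φ ⇒ ψ))
        → ⊢ Λ ((φ ∧′ ◇ (φ ∧′ ψ)) ⇒ ψ)
        → ⊢ Λ (γ φ ψ ⇒ ◇ (φ ∧′ ψ))
  axPLR : ∀ {φ} → Λ ≡ PLR → ⊢ Λ (□ (□ (φ ⇒ □ φ) ⇒ φ) ⇒ □ φ)

-- Sets of formulas, consistency, maximal consistent sets (elements of W_c)

FSet : Set₁
FSet = Formula → Set

Consistent : Logic → FSet → Set
Consistent Λ Γ = ∀ (l : List Formula) → All Γ l → ¬ ⊢ Λ (¬′ (⋀ l))

_∪｛_｝ : FSet → Formula → FSet
(Γ ∪｛ φ ｝) χ = Γ χ ⊎ χ ≡ φ

MCS : Logic → FSet → Set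
MCS Λ Γ = Consistent Λ Γ × (∀ φ → Consistent Λ (Γ ∪｛ φ ｝) → Γ φ)

IsNeg : Formula → Set
IsNeg (¬′ _) = ⊤
IsNeg _      = ⊥

record Adequate (Sg : FSet) : Set where
  field
    sub¬  : ∀ {φ} → Sg (¬′ φ) → Sg φ
    sub∧ˡ : ∀ {φ ψ} → Sg (φ ∧′ ψ) → Sg φ
    sub∧ʳ : ∀ {φ ψ} → Sg (φ ∧′ ψ) → Sg ψ
    sub□  : ∀ {φ} → Sg (□ φ) → Sg φ
    subγˡ : ∀ {φ ψ} → Sg (γ φ ψ) → Sg φ
    subγʳ : ∀ {φ ψ} → Sg (γ φ ψ) → Sg ψ
    neg   : ∀ {φ} → Sg φ → ¬ IsNeg φ → Sg (¬′ φ)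
    γ□    : ∀ {φ ψ} → Sg (γ φ ψ) → Sg (□ (φ ⇒ γ φ ψ))
    γ◇    : ∀ {φ ψ} → Sg (γ φ ψ) → Sg (◇ (φ ∧′ γ φ ψ))

-- Filtration relations, stated on representatives of Σ-classes.
-- (≼Σ only depends on T ∩ Σ and S ∩ Σ, so this is the relation on W_Σ.)

_≼[_]_ : FSet → FSet → FSet → Set
T ≼[ Sg ] S = ∀ χ → Sg (□ χ) → T (□ χ) → S (□ χ)

data R (Λ : Logic) (Sg : FSet) (φ : Formula) : FSet → FSet → Set₁ where
  base  : ∀ {T S} (U : FSet) → MCS Λ U → U φ
        → T ≼[ Sg ] U → S ≼[ Sg ] U → R Λ Sg φ T S
  trans : ∀ {T S} (U : FSet) → MCS Λ U → U φ
        → R Λ Sg φ T U → R Λ Sg φ U S → R Λ Sg φ T S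

{-# OPTIONS --safe #-}

-- In the base clause T ≼ U ≽ S with
-- φ ∈ U: Axiom 1 puts □(φ → γ(φ,ψ)) into S; it lies in Σ, so it passes to U,
-- and U contains φ ∧ γ(φ,ψ).  Then □¬(φ ∧ γ(φ,ψ)) ∈ Σ cannot lie in T (it would
-- pass to U), so ◇(φ ∧ γ(φ,ψ)) ∈ T and Axiom 2 gives γ(φ,ψ) ∈ T.  In the
-- transitive clause through U, the hypothesis for U R S gives γ(φ,ψ) ∈ U, hence
-- φ ∧ γ(φ,ψ) ∈ U, which is the second alternative needed for T R U.

module Submission where

open import Defs
open import Data.Bool using (Bool; true; false; not; _∧_)
import Data.Bool as Bool
open import Data.Bool.Properties using (T-∧; T-≡)
open import Data.Fin using (Fin; zero; suc)
open import Data.List using (List; []; _∷_; _++_)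
open import Data.List.Relation.Unary.All using (All; []; _∷_)
open import Data.List.Relation.Unary.All.Properties using (++⁺)
open import Data.Nat using (ℕ; zero; suc; _+_)
open import Data.Product using (∃; _×_; _,_; proj₁; proj₂)
open import Data.Sum using (_⊎_; inj₁; inj₂)
open import Data.Vec using (Vec; []; _∷_; lookup; map)
open import Data.Vec.Properties using (lookup-map)
open import Function.Bundles using (Equivalence)
open import Relation.Nullary using (¬_)
open import Relation.Binary.PropositionalEquality
  using (_≡_; refl; sym; cong; cong₂; module ≡-Reasoning)

private
  variable
    n : ℕ
    Λ : Logic
    Sg Γ T U S : FSet
    a b c φ ψ χ : Formula
    as ks ls : List Formula

infixr 6 _∧ˢ_
infixr 5 _∨ˢ_
infixr 4 _⇒ˢ_

data Schema (n : ℕ) : Set where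
  atom : Fin n → Schema n
  ⊤ˢ   : Schema n
  ¬ˢ   : Schema n → Schema n
  _∧ˢ_ : Schema n → Schema n → Schema n

_⇒ˢ_ : Schema n → Schema n → Schema n
s ⇒ˢ t = ¬ˢ (s ∧ˢ ¬ˢ t)

_∨ˢ_ : Schema n → Schema n → Schema n
s ∨ˢ t = ¬ˢ (¬ˢ s ∧ˢ ¬ˢ t)

x₀ : Schema (1 + n)
x₀ = atom zero

x₁ : Schema (2 + n)
x₁ = atom (suc zero)

x₂ : Schema (3 + n)
x₂ = atom (suc (suc zero))

x₃ : Schema (4 + n)
x₃ = atom (suc (suc (suc zero)))

x₄ : Schema (5 + n)
x₄ = atom (suc (suc (suc (suc zero))))

instantiate : Vec Formula n → Schema n → Formula
instantiate ρ (atom i) = lookup ρ i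
instantiate ρ ⊤ˢ       = ⊤′
instantiate ρ (¬ˢ s)   = ¬′ (instantiate ρ s)
instantiate ρ (s ∧ˢ t) = instantiate ρ s ∧′ instantiate ρ t

truth : Vec Bool n → Schema n → Bool
truth β (atom i) = lookup β i
truth β ⊤ˢ       = true
truth β (¬ˢ s)   = not (truth β s)
truth β (s ∧ˢ t) = truth β s ∧ truth β t

eval-instantiate : ∀ v (ρ : Vec Formula n) s →
                   eval v (instantiate ρ s) ≡ truth (map (eval v) ρ) s
eval-instantiate v ρ (atom i) = sym (lookup-map i (eval v) ρ)
eval-instantiate v ρ ⊤ˢ with v (var 0)
... | true  = refl
... | false = refl
eval-instantiate v ρ (¬ˢ s)   = cong not (eval-instantiate v ρ s)
eval-instantiate v ρ (s ∧ˢ t) =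
  cong₂ _∧_ (eval-instantiate v ρ s) (eval-instantiate v ρ t)

allValuations : ∀ n → (Vec Bool n → Bool) → Bool
allValuations zero    f = f []
allValuations (suc n) f =
  allValuations n (λ β → f (true ∷ β)) ∧ allValuations n (λ β → f (false ∷ β))

allValuations-sound : ∀ n f → Bool.T (allValuations n f) → ∀ β → Bool.T (f β)
allValuations-sound zero    f holds [] = holds
allValuations-sound (suc n) f holds (true ∷ β) =
  allValuations-sound n _ (proj₁ (Equivalence.to T-∧ holds)) β
allValuations-sound (suc n) f holds (false ∷ β) =
  allValuations-sound n _ (proj₂ (Equivalence.to T-∧ holds)) β

tautology : (ρ : Vec Formula n) (s : Schema n) →
            {Bool.T (allValuations n (λ β → truth β s))} → ⊢ Λ (instantiate ρ s)
tautology ρ s {holds} = taut λ v → begin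
  eval v (instantiate ρ s)  ≡⟨ eval-instantiate v ρ s ⟩
  truth (map (eval v) ρ) s  ≡⟨ Equivalence.to T-≡ (allValuations-sound _ _ holds (map (eval v) ρ)) ⟩
  true                      ∎
  where open ≡-Reasoning

_⇛_ : List Formula → Formula → Formula
[]       ⇛ c = c
(a ∷ as) ⇛ c = a ⇒ (as ⇛ c)

mp* : All (⊢ Λ) as → ⊢ Λ (as ⇛ c) → ⊢ Λ c
mp* []         ⊢c    = ⊢c
mp* (⊢a ∷ ⊢as) ⊢a⇛c = mp* ⊢as (mp ⊢a ⊢a⇛c)

⋀-++ : ∀ ks ls → ⊢ Λ (⋀ (ks ++ ls) ⇒ ⋀ ks ∧′ ⋀ ls)
⋀-++ []       ls = tautology (⋀ ls ∷ []) (x₀ ⇒ˢ ⊤ˢ ∧ˢ x₀)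
⋀-++ (k ∷ ks) ls = mp* (⋀-++ ks ls ∷ [])
  (tautology (_ ∷ _ ∷ _ ∷ k ∷ [])
    ((x₀ ⇒ˢ x₁ ∧ˢ x₂) ⇒ˢ x₃ ∧ˢ x₀ ⇒ˢ (x₃ ∧ˢ x₁) ∧ˢ x₂))

discharge : All (Γ ∪｛ b ｝) ls → ∃ λ ls′ → All Γ ls′ × ⊢ Λ (b ∧′ ⋀ ls′ ⇒ ⋀ ls)
discharge {b = b} [] = [] , [] , tautology (b ∷ []) (x₀ ∧ˢ ⊤ˢ ⇒ˢ ⊤ˢ)
discharge {ls = c ∷ _} (inj₁ Γc ∷ Γbls) with discharge Γbls
... | ls′ , Γls′ , ⊢ls′ = c ∷ ls′ , Γc ∷ Γls′ , mp* (⊢ls′ ∷ [])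
  (tautology (_ ∷ _ ∷ _ ∷ c ∷ [])
    ((x₀ ∧ˢ x₁ ⇒ˢ x₂) ⇒ˢ x₀ ∧ˢ x₃ ∧ˢ x₁ ⇒ˢ x₃ ∧ˢ x₂))
discharge (inj₂ refl ∷ Γbls) with discharge Γbls
... | ls′ , Γls′ , ⊢ls′ = ls′ , Γls′ , mp* (⊢ls′ ∷ [])
  (tautology (_ ∷ _ ∷ _ ∷ [])
    ((x₀ ∧ˢ x₁ ⇒ˢ x₂) ⇒ˢ x₀ ∧ˢ x₁ ⇒ˢ x₀ ∧ˢ x₂))

mcs-closed : MCS Λ Γ → All Γ ks → ⊢ Λ (⋀ ks ⇒ b) → Γ b
mcs-closed {ks = ks} (consistent , maximal) Γks ⊢ks⇒b = maximal _ λ ls Γbls ⊢¬ls →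
  let ls′ , Γls′ , ⊢b∧ls′⇒ls = discharge Γbls
  in consistent (ks ++ ls′) (++⁺ Γks Γls′)
       (mp* (⋀-++ ks ls′ ∷ ⊢ks⇒b ∷ ⊢b∧ls′⇒ls ∷ ⊢¬ls ∷ [])
         (tautology (_ ∷ _ ∷ _ ∷ _ ∷ _ ∷ [])
           ((x₀ ⇒ˢ x₁ ∧ˢ x₂) ⇒ˢ (x₁ ⇒ˢ x₃) ⇒ˢ (x₃ ∧ˢ x₂ ⇒ˢ x₄) ⇒ˢ ¬ˢ x₄ ⇒ˢ ¬ˢ x₀)))

mcs-closed₁ : MCS Λ Γ → Γ a → ⊢ Λ (a ⇒ b) → Γ b
mcs-closed₁ mcs Γa ⊢a⇒b = mcs-closed mcs (Γa ∷ [])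
  (mp* (⊢a⇒b ∷ []) (tautology (_ ∷ _ ∷ []) ((x₀ ⇒ˢ x₁) ⇒ˢ x₀ ∧ˢ ⊤ˢ ⇒ˢ x₁)))

mcs-closed₂ : MCS Λ Γ → Γ a → Γ b → ⊢ Λ (a ∧′ b ⇒ c) → Γ c
mcs-closed₂ mcs Γa Γb ⊢a∧b⇒c = mcs-closed mcs (Γa ∷ Γb ∷ [])
  (mp* (⊢a∧b⇒c ∷ [])
    (tautology (_ ∷ _ ∷ _ ∷ []) ((x₀ ∧ˢ x₁ ⇒ˢ x₂) ⇒ˢ x₀ ∧ˢ x₁ ∧ˢ ⊤ˢ ⇒ˢ x₂)))

mcs-∧ : MCS Λ Γ → Γ a → Γ b → Γ (a ∧′ b)
mcs-∧ mcs Γa Γb =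
  mcs-closed₂ mcs Γa Γb (tautology (_ ∷ _ ∷ []) (x₀ ∧ˢ x₁ ⇒ˢ x₀ ∧ˢ x₁))

mcs-mp : MCS Λ Γ → Γ a → Γ (a ⇒ b) → Γ b
mcs-mp mcs Γa Γa⇒b =
  mcs-closed₂ mcs Γa Γa⇒b (tautology (_ ∷ _ ∷ []) (x₀ ∧ˢ (x₀ ⇒ˢ x₁) ⇒ˢ x₁))

mcs-∨ : MCS Λ Γ → Γ a ⊎ Γ b → Γ (a ∨′ b)
mcs-∨ mcs (inj₁ Γa) = mcs-closed₁ mcs Γa (tautology (_ ∷ _ ∷ []) (x₀ ⇒ˢ x₀ ∨ˢ x₁))
mcs-∨ mcs (inj₂ Γb) = mcs-closed₁ mcs Γb (tautology (_ ∷ _ ∷ []) (x₁ ⇒ˢ x₀ ∨ˢ x₁))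

mcs-□ : MCS Λ Γ → Γ (□ a) → Γ a
mcs-□ mcs Γ□a = mcs-closed₁ mcs Γ□a axT

mcs-¬⇒∉ : MCS Λ Γ → Γ (¬′ a) → ¬ Γ a
mcs-¬⇒∉ (consistent , _) Γ¬a Γa = consistent (_ ∷ _ ∷ []) (Γa ∷ Γ¬a ∷ [])
  (tautology (_ ∷ []) (¬ˢ (x₀ ∧ˢ ¬ˢ x₀ ∧ˢ ⊤ˢ)))

mcs-∉⇒¬ : MCS Λ Γ → ¬ Γ a → Γ (¬′ a)
mcs-∉⇒¬ mcs@(_ , maximal) a∉Γ = maximal _ λ ls Γ¬als ⊢¬ls →
  let ls′ , Γls′ , ⊢¬a∧ls′⇒ls = discharge Γ¬als
  in a∉Γ (mcs-closed mcs Γls′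
       (mp* (⊢¬a∧ls′⇒ls ∷ ⊢¬ls ∷ [])
         (tautology (_ ∷ _ ∷ _ ∷ []) ((¬ˢ x₀ ∧ˢ x₁ ⇒ˢ x₂) ⇒ˢ ¬ˢ x₂ ⇒ˢ x₁ ⇒ˢ x₀))))

≼-◇ : MCS Λ T → MCS Λ U → T ≼[ Sg ] U → Sg (□ (¬′ χ)) → U χ → T (◇ χ)
≼-◇ mT mU T≼U Σ□¬χ Uχ =
  mcs-∉⇒¬ mT λ T□¬χ → mcs-¬⇒∉ mU (mcs-□ mU (T≼U _ Σ□¬χ T□¬χ)) Uχ

γ-along-≼≽ : Adequate Sg → Sg (γ φ ψ) → MCS Λ T → MCS Λ U → MCS Λ S →
             T ≼[ Sg ] U → S ≼[ Sg ] U → U φ → S ψ ⊎ S (φ ∧′ γ φ ψ) → T (γ φ ψ)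
γ-along-≼≽ {Sg = Sg} {φ = φ} {ψ = ψ} {T = T} {U = U} {S = S}
           ad Σγ mT mU mS T≼U S≼U Uφ Sψ⊎Sφγ = mcs-closed₁ mT T◇φγ ax2
  where
  open Adequate ad
  S□φ⇒γ : S (□ (φ ⇒ γ φ ψ))
  S□φ⇒γ = mcs-closed₁ mS (mcs-∨ mS Sψ⊎Sφγ) ax1
  Uγ : U (γ φ ψ)
  Uγ = mcs-mp mU Uφ (mcs-□ mU (S≼U _ (γ□ Σγ) S□φ⇒γ))
  T◇φγ : T (◇ (φ ∧′ γ φ ψ))
  T◇φγ = ≼-◇ {Sg = Sg} mT mU T≼U (sub¬ (γ◇ Σγ)) (mcs-∧ mU Uφ Uγ)

mainTheorem12 : (Λ : Logic) (Sg : FSet) → Adequate Sg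
    → (φ ψ : Formula) → Sg (γ φ ψ)
    → (T S : FSet) → MCS Λ T → MCS Λ S
    → R Λ Sg φ T S
    → S ψ ⊎ S (φ ∧′ γ φ ψ)
    → T (γ φ ψ)
mainTheorem12 Λ Sg ad φ ψ Σγ T S mT mS (base U mU Uφ T≼U S≼U) Sψ⊎Sφγ =
  γ-along-≼≽ ad Σγ mT mU mS T≼U S≼U Uφ Sψ⊎Sφγ
mainTheorem12 Λ Sg ad φ ψ Σγ T S mT mS (trans U mU Uφ TRU URS) Sψ⊎Sφγ =
  mainTheorem12 Λ Sg ad φ ψ Σγ T U mT mU TRU (inj₂ (mcs-∧ mU Uφ Uγ))
  where
  Uγ : U (γ φ ψ)
  Uγ = mainTheorem12 Λ Sg ad φ ψ Σγ U S mU mS URS Sψ⊎Sφγ
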